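{- Let $r\in\mathbb{N}$, let $f_1,\ldots,f_r:\mathbb{N}\to\mathbb{C}$ be multiplicative arithmetical functions and $G=(g_1,\ldots,g_r)$ any system of polynomials with integer coefficients. For $m_1,\ldots,m_r\in\mathbb{N}$ put \[ S_F^{(G)}(m_1,\ldots,m_r)=\frac{1}{M}\sum_{k=1}^{M} f_1(\gcd(g_1(k),m_1))\cdots f_r(\gcd(g_r(k),m_r)), \] where $M$ is any positive integer multiple of $\operatorname{lcm}[m_1,\ldots,m_r]$ (the value does not depend on this choice). Then $(m_1,\ldots,m_r)\mapsto S_F^{(G)}(m_1,\ldots,m_r)$ is multiplicative.
   Context: $\mathbb{N}=\{1,2,\ldots\}$. A one-variable arithmetical function $f$ is multiplicative if $f(1)=1$ and $f(ab)=f(a)f(b)$ whenever $\gcd(a,b)=1$. A function $h:\mathbb{N}^r\to\mathbb{C}$ is called multiplicative if it is not identically zero and $h(m_1n_1,\ldots,m_rn_r)=h(m_1,\ldots,m_r)h(n_1,\ldots,n_r)$ for all $m_1,\ldots,m_r,n_1,\ldots,n_r\in\mathbb{N}$ with $\gcd(m_1\cdots m_r,n_1\cdots n_r)=1$. -}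

module Defs where

open import Level using (Level; _⊔_) renaming (suc to lsuc)
open import Algebra.Bundles using (CommutativeRing)
open import Data.Nat using (ℕ; zero; suc; NonZero) renaming (_*_ to _*ℕ_)
open import Data.Nat.GCD using (gcd)
open import Data.Nat.LCM using (lcm)
open import Data.Nat.Coprimality using (Coprime)
open import Data.Integer as ℤ using (ℤ; +_; ∣_∣)
open import Data.Fin using (Fin; zero; suc)
open import Data.List using (List; []; _∷_)
open import Data.Product using (Σ; _×_)
open import Relation.Nullary using (¬_)

-- Integer polynomials, coefficient list with the constant term first:
-- a₀ ∷ a₁ ∷ … represents a₀ + a₁ x + a₂ x² + …
IntPoly : Set
IntPoly = List ℤ

eval : IntPoly → ℤ → ℤ
eval []       x = + 0
eval (a ∷ as) x = a ℤ.+ x ℤ.* eval as x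

prodℕ : ∀ {r} → (Fin r → ℕ) → ℕ
prodℕ {zero}  m = 1
prodℕ {suc r} m = m zero *ℕ prodℕ (λ i → m (suc i))

lcmFin : ∀ {r} → (Fin r → ℕ) → ℕ
lcmFin {zero}  m = 1
lcmFin {suc r} m = lcm (m zero) (lcmFin (λ i → m (suc i)))

fromℕ : ∀ {c ℓ} (R : CommutativeRing c ℓ) → ℕ → CommutativeRing.Carrier R
fromℕ R zero    = CommutativeRing.0# R
fromℕ R (suc n) = CommutativeRing._+_ R (CommutativeRing.1# R) (fromℕ R n)

-- Value ring: a nontrivial commutative ring in which every positive integer
-- is invertible (i.e. a ℚ-algebra); ℂ is an instance.
record ℚAlgebra (c ℓ : Level) : Set (lsuc (c ⊔ ℓ)) where
  field
    R : CommutativeRing c ℓ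
  open CommutativeRing R public
  field
    nontrivial  : ¬ (1# ≈ 0#)
    inv         : ℕ → Carrier
    inv-correct : ∀ n → NonZero n → fromℕ R n * inv n ≈ 1#

module _ {c ℓ : Level} (A : ℚAlgebra c ℓ) where
  open ℚAlgebra A using (Carrier; _≈_; _+_; _*_; 0#; 1#; inv)

  sumTo : ℕ → (ℕ → Carrier) → Carrier
  sumTo zero    h = 0#
  sumTo (suc M) h = sumTo M h + h (suc M)

  prodFin : ∀ {r} → (Fin r → Carrier) → Carrier
  prodFin {zero}  h = 1#
  prodFin {suc r} h = h zero * prodFin (λ i → h (suc i))

  IsMultiplicative : (ℕ → Carrier) → Set ℓ
  IsMultiplicative f =
    (f 1 ≈ 1#) ×
    (∀ a b → NonZero a → NonZero b → Coprime a b → f (a *ℕ b) ≈ f a * f b)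

  IsMultiplicativeᵣ : ∀ {r} → ((Fin r → ℕ) → Carrier) → Set ℓ
  IsMultiplicativeᵣ {r} h =
    (Σ (Fin r → ℕ) λ m → (∀ i → NonZero (m i)) × ¬ (h m ≈ 0#)) ×
    (∀ (m n : Fin r → ℕ) → (∀ i → NonZero (m i)) → (∀ i → NonZero (n i)) →
       Coprime (prodℕ m) (prodℕ n) →
       h (λ i → m i *ℕ n i) ≈ h m * h n)

  S : ∀ {r} → (Fin r → ℕ → Carrier) → (Fin r → IntPoly) → (Fin r → ℕ) → Carrier
  S F G m =
    inv (lcmFin m) *
      sumTo (lcmFin m) (λ k → prodFin (λ i → F i (gcd ∣ eval (G i) (+ k) ∣ (m i))))

module Submission where

-- Write term m k for the summand.  Three facts suffice.
--  (1) Integer polynomials preserve congruences, so k ↦ gcd(g(k), m) has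
--      period m and term m has every common multiple of the mᵢ as a period;
--      the mean of a periodic family over any positive multiple of a period
--      equals its mean over the period.
--  (2) For fixed k, term is multiplicative in m: gcd(x, ·) is multiplicative
--      on coprime arguments and so is every fᵢ.
--  (3) Chinese remainder theorem for means: for a of period p and b of period
--      q with p, q coprime, the mean of a·b over pq is the product of the
--      means; s ↦ s q + j permutes the residues modulo p.
-- For m, n with coprime products, S(mn) is then the mean of term m · term n
-- over lcm(m) lcm(n), which is S(m) S(n); and S(1,…,1) = 1 ≠ 0.
-- The modules below provide, in order: the arithmetic on ℕ, ℤ and Fin; sums
-- of periodic families in a commutative semiring; means in a ℚ-algebra;
-- finite products; and the multiplicativity of S, from which corollary1 follows.

open import Level using (Level)
open import Algebra.Bundles using (CommutativeSemiring)
open import Function.Base using (_∘_)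
open import Function.Definitions using (Injective)
open import Data.Product using (Σ; _,_; proj₁; proj₂)
open import Relation.Binary.PropositionalEquality as ≡ using (_≡_)
open import Relation.Nullary using (¬_; yes; no)
open import Relation.Nullary.Negation using (contradiction)

open import Data.Nat as ℕ using (ℕ; zero; suc; NonZero; _<_; _≤_)
import Data.Nat.Properties as ℕP
open import Data.Nat.Divisibility
  using (_∣_; divides; ∣-trans; ∣-antisym; *-pres-∣; *-monoʳ-∣; m∣m*n; n∣m*n; 0∣⇒≡0; 1∣_; _∣0; >⇒∤)
open import Data.Nat.DivMod using (_%_; _/_; m≡m%n+[m/n]*n; m%n<n)
open import Data.Nat.GCD using (gcd; gcd[m,n]∣m; gcd[m,n]∣n; gcd-greatest; c*gcd[m,n]≡gcd[cm,cn]; gcd-zeroʳ)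
open import Data.Nat.LCM using (m∣lcm[m,n]; n∣lcm[m,n]; lcm-least)
open import Data.Nat.Coprimality as Coprimality using (Coprime; coprime-divisor)
open import Data.Integer as ℤ using (ℤ; +_; ∣_∣)
import Data.Integer.Properties as ℤP
import Data.Integer.Divisibility.Signed as ℤD
open import Data.Integer.Tactic.RingSolver using (solve-∀)
open import Data.Fin as Fin using (Fin; toℕ; fromℕ<; punchOut)
open import Data.Fin.Permutation using (Permutation; permutation)
import Data.Fin.Properties as FinP
open import Data.List using ([]; _∷_)

open import Defs

module Arithmetic where
  open import Data.Nat using (_+_; _*_; _∸_)
  open ≡ using (refl; sym; trans; cong; cong₂; subst; module ≡-Reasoning)

  polynomial-congruence : ∀ g {d x y : ℤ} → d ℤD.∣ (x ℤ.- y) → d ℤD.∣ (eval g x ℤ.- eval g y)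
  polynomial-congruence []       {d} _   = ℤD.∣ᵤ⇒∣ (∣ d ∣ ∣0)
  polynomial-congruence (a ∷ as) {d} {x} {y} d∣x-y =
    subst (d ℤD.∣_) (sym (horner-step a x y (eval as x) (eval as y)))
      (ℤD.∣m∣n⇒∣m+n (ℤD.∣n⇒∣m*n x (polynomial-congruence as d∣x-y)) (ℤD.∣m⇒∣m*n (eval as y) d∣x-y))
    where
    -- g = a + x·g′ (Horner), so g(x) - g(y) = x (g′(x) - g′(y)) + (x - y) g′(y)
    horner-step : ∀ a x y p q → (a ℤ.+ x ℤ.* p) ℤ.- (a ℤ.+ y ℤ.* q) ≡ x ℤ.* (p ℤ.- q) ℤ.+ (x ℤ.- y) ℤ.* q
    horner-step = solve-∀

  gcd-mod-invariant : ∀ u v m → (+ m) ℤD.∣ (u ℤ.- v) → gcd (∣ u ∣) m ≡ gcd (∣ v ∣) m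
  gcd-mod-invariant u v m m∣u-v =
    ∣-antisym (gcd-transfer u v m∣u-v) (gcd-transfer v u m∣v-u)
    where
    m∣v-u : (+ m) ℤD.∣ (v ℤ.- u)
    m∣v-u = subst ((+ m) ℤD.∣_) (negate-difference u v) (ℤD.∣m⇒∣-m m∣u-v)
      where
      negate-difference : ∀ u v → ℤ.- (u ℤ.- v) ≡ v ℤ.- u
      negate-difference = solve-∀
    -- a common divisor of u and m divides v = u - (u - v)
    gcd-transfer : ∀ u v → (+ m) ℤD.∣ (u ℤ.- v) → gcd (∣ u ∣) m ∣ gcd (∣ v ∣) m
    gcd-transfer u v m∣u-v = gcd-greatest c∣v (gcd[m,n]∣n (∣ u ∣) m)
      where
      c : ℕ
      c = gcd (∣ u ∣) m
      c∣u : (+ c) ℤD.∣ u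
      c∣u = ℤD.∣ᵤ⇒∣ (gcd[m,n]∣m (∣ u ∣) m)
      c∣u-v : (+ c) ℤD.∣ (u ℤ.- v)
      c∣u-v = ℤD.∣-trans (ℤD.∣ᵤ⇒∣ (gcd[m,n]∣n (∣ u ∣) m)) m∣u-v
      u-[u-v]≡v : ∀ u v → u ℤ.- (u ℤ.- v) ≡ v
      u-[u-v]≡v = solve-∀
      c∣v : c ∣ (∣ v ∣)
      c∣v = ℤD.∣⇒∣ᵤ (subst ((+ c) ℤD.∣_) (u-[u-v]≡v u v) (ℤD.∣m∣n⇒∣m-n c∣u c∣u-v))

  gcd-poly-periodic : ∀ g m {d} x → m ∣ d → gcd (∣ eval g (+ (d + x)) ∣) m ≡ gcd (∣ eval g (+ x) ∣) m
  gcd-poly-periodic g m {d} x m∣d =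
    gcd-mod-invariant (eval g (+ (d + x))) (eval g (+ x)) m (polynomial-congruence g (subst ((+ m) ℤD.∣_) (sym shift-difference) (ℤD.∣ᵤ⇒∣ m∣d)))
    where
    shift-difference : + (d + x) ℤ.- + x ≡ + d
    shift-difference = trans (cong (ℤ._- + x) (ℤP.pos-+ d x)) (cancel (+ d) (+ x))
      where
      cancel : ∀ d x → d ℤ.+ x ℤ.- x ≡ d
      cancel = solve-∀

  coprime-∣ : ∀ {a b A B} → a ∣ A → b ∣ B → Coprime A B → Coprime a b
  coprime-∣ a∣A b∣B cop (d∣a , d∣b) = cop (∣-trans d∣a a∣A , ∣-trans d∣b b∣B)

  coprime-*-∣ : ∀ {a b x} → Coprime a b → a ∣ x → b ∣ x → a * b ∣ x
  coprime-*-∣ {a} {b} cop (divides q refl) b∣qa =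
    subst (a * b ∣_) (ℕP.*-comm a q) (*-monoʳ-∣ a b∣q)
    where
    b∣q : b ∣ q
    b∣q = coprime-divisor (Coprimality.sym cop) (subst (b ∣_) (ℕP.*-comm q a) b∣qa)

  gcd-*-coprime : ∀ x m n → Coprime m n → gcd x (m * n) ≡ gcd x m * gcd x n
  gcd-*-coprime x m n cop = ∣-antisym d∣g₁g₂ g₁g₂∣d
    where
    g₁ g₂ d : ℕ
    g₁ = gcd x m
    g₂ = gcd x n
    d  = gcd x (m * n)
    -- g₁ and g₂ are coprime divisors of x, and g₁ g₂ divides m n
    g₁g₂∣d : g₁ * g₂ ∣ d
    g₁g₂∣d = gcd-greatest
      (coprime-*-∣ (coprime-∣ (gcd[m,n]∣n x m) (gcd[m,n]∣n x n) cop) (gcd[m,n]∣m x m) (gcd[m,n]∣m x n))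
      (*-pres-∣ (gcd[m,n]∣n x m) (gcd[m,n]∣n x n))
    d∣x : d ∣ x
    d∣x = gcd[m,n]∣m x (m * n)
    -- d divides n x and n m, hence n g₁ = gcd(n x, n m)
    d∣g₁n : d ∣ g₁ * n
    d∣g₁n = subst (d ∣_) (trans (sym (c*gcd[m,n]≡gcd[cm,cn] n x m)) (ℕP.*-comm n g₁))
      (gcd-greatest (∣-trans d∣x (n∣m*n n)) (subst (d ∣_) (ℕP.*-comm m n) (gcd[m,n]∣n x (m * n))))
    -- d divides g₁ x and g₁ n, hence g₁ g₂ = gcd(g₁ x, g₁ n)
    d∣g₁g₂ : d ∣ g₁ * g₂
    d∣g₁g₂ = subst (d ∣_) (sym (c*gcd[m,n]≡gcd[cm,cn] g₁ x n)) (gcd-greatest (∣-trans d∣x (n∣m*n g₁)) d∣g₁n)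

  divisor-nonZero : ∀ {a b} → a ∣ b → NonZero b → NonZero a
  divisor-nonZero {zero}  0∣b b≢0 = contradiction (0∣⇒≡0 0∣b) (ℕ.≢-nonZero⁻¹ _ {{b≢0}})
  divisor-nonZero {suc a} _   _   = _

  lcmFin-∣ : ∀ {r} (m : Fin r → ℕ) i → m i ∣ lcmFin m
  lcmFin-∣ m Fin.zero    = m∣lcm[m,n] _ _
  lcmFin-∣ m (Fin.suc i) = ∣-trans (lcmFin-∣ (m ∘ Fin.suc) i) (n∣lcm[m,n] (m Fin.zero) _)

  lcmFin-least : ∀ {r} (m : Fin r → ℕ) {M} → (∀ i → m i ∣ M) → lcmFin m ∣ M
  lcmFin-least {zero}  m m∣M = 1∣ _
  lcmFin-least {suc r} m m∣M = lcm-least (m∣M Fin.zero) (lcmFin-least (m ∘ Fin.suc) (m∣M ∘ Fin.suc))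

  prodℕ-∣ : ∀ {r} (m : Fin r → ℕ) i → m i ∣ prodℕ m
  prodℕ-∣ m Fin.zero    = m∣m*n _
  prodℕ-∣ m (Fin.suc i) = ∣-trans (prodℕ-∣ (m ∘ Fin.suc) i) (n∣m*n (m Fin.zero))

  prodℕ-nonZero : ∀ {r} (m : Fin r → ℕ) → (∀ i → NonZero (m i)) → NonZero (prodℕ m)
  prodℕ-nonZero {zero}  m m≢0 = _
  prodℕ-nonZero {suc r} m m≢0 =
    ℕP.m*n≢0 (m Fin.zero) _ {{m≢0 Fin.zero}} {{prodℕ-nonZero (m ∘ Fin.suc) (m≢0 ∘ Fin.suc)}}

  lcmFin∣prodℕ : ∀ {r} (m : Fin r → ℕ) → lcmFin m ∣ prodℕ m
  lcmFin∣prodℕ m = lcmFin-least m (prodℕ-∣ m)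

  lcmFin-nonZero : ∀ {r} (m : Fin r → ℕ) → (∀ i → NonZero (m i)) → NonZero (lcmFin m)
  lcmFin-nonZero m m≢0 = divisor-nonZero (lcmFin∣prodℕ m) (prodℕ-nonZero m m≢0)

  %-≡⇒∣∸ : ∀ B .{{_ : NonZero B}} x y → x % B ≡ y % B → B ∣ y ∸ x
  %-≡⇒∣∸ B x y same-residue = divides (y / B ∸ x / B) (begin
    y ∸ x                                     ≡⟨ cong₂ _∸_ (m≡m%n+[m/n]*n y B) (m≡m%n+[m/n]*n x B) ⟩
    (y % B + y / B * B) ∸ (x % B + x / B * B) ≡⟨ cong (λ r → (y % B + y / B * B) ∸ (r + x / B * B)) same-residue ⟩
    (y % B + y / B * B) ∸ (y % B + x / B * B) ≡⟨ ℕP.[m+n]∸[m+o]≡n∸o (y % B) _ _ ⟩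
    y / B * B ∸ x / B * B                     ≡⟨ ℕP.*-distribʳ-∸ B (y / B) (x / B) ⟨
    (y / B ∸ x / B) * B                       ∎)
    where open ≡-Reasoning

  ∣-<⇒≡0 : ∀ {d n} → d ∣ n → n < d → n ≡ 0
  ∣-<⇒≡0 {n = zero}  _   _   = refl
  ∣-<⇒≡0 {n = suc n} d∣n n<d = contradiction d∣n (>⇒∤ n<d)

  affine : ∀ B .{{_ : NonZero B}} (A j : ℕ) → Fin B → Fin B
  affine B A j s = fromℕ< (m%n<n (toℕ s * A + j) B)

  -- If s A + j ≡ t A + j (mod B) with t < B and B coprime to A, then B ∣ t - s forces t ≤ s.
  affine-≤ : ∀ B .{{_ : NonZero B}} A j → Coprime B A → ∀ s t → t < B →
             (s * A + j) % B ≡ (t * A + j) % B → t ≤ s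
  affine-≤ B A j cop s t t<B residues =
    ℕP.m∸n≡0⇒m≤n (∣-<⇒≡0 B∣t∸s (ℕP.≤-<-trans (ℕP.m∸n≤m t s) t<B))
    where
    open ≡-Reasoning
    difference : (t * A + j) ∸ (s * A + j) ≡ A * (t ∸ s)
    difference = begin
      (t * A + j) ∸ (s * A + j) ≡⟨ cong₂ _∸_ (ℕP.+-comm (t * A) j) (ℕP.+-comm (s * A) j) ⟩
      (j + t * A) ∸ (j + s * A) ≡⟨ ℕP.[m+n]∸[m+o]≡n∸o j (t * A) (s * A) ⟩
      t * A ∸ s * A             ≡⟨ ℕP.*-distribʳ-∸ A t s ⟨
      (t ∸ s) * A               ≡⟨ ℕP.*-comm (t ∸ s) A ⟩
      A * (t ∸ s)               ∎
    B∣t∸s : B ∣ t ∸ s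
    B∣t∸s = coprime-divisor cop (subst (B ∣_) difference (%-≡⇒∣∸ B _ _ residues))

  affine-injective : ∀ B .{{_ : NonZero B}} A j → Coprime B A → Injective _≡_ _≡_ (affine B A j)
  affine-injective B A j cop {s} {t} as≡at = FinP.toℕ-injective (ℕP.≤-antisym
    (affine-≤ B A j cop (toℕ t) (toℕ s) (FinP.toℕ<n s) (sym residues))
    (affine-≤ B A j cop (toℕ s) (toℕ t) (FinP.toℕ<n t) residues))
    where
    residues : (toℕ s * A + j) % B ≡ (toℕ t * A + j) % B
    residues = trans (sym (FinP.toℕ-fromℕ< _)) (trans (cong toℕ as≡at) (FinP.toℕ-fromℕ< _))

  -- Pigeonhole: an injective map Fin n → Fin n is surjective.  If y were
  -- missed, punching y out would give an injection Fin n → Fin (n - 1).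
  injective⇒surjective : ∀ {n} (f : Fin n → Fin n) → Injective _≡_ _≡_ f →
                         ∀ y → Σ (Fin n) λ x → f x ≡ y
  injective⇒surjective {suc n} f f-inj y with FinP.any? (λ x → f x FinP.≟ y)
  ... | yes hit = hit
  ... | no  miss = contradiction (FinP.injective⇒≤ f∖y-injective) (ℕP.<-irrefl refl)
    where
    f∖y : Fin (suc n) → Fin n
    f∖y x = punchOut {i = y} {j = f x} (λ y≡fx → miss (x , sym y≡fx))
    f∖y-injective : Injective _≡_ _≡_ f∖y
    f∖y-injective {x} {x′} eq =
      f-inj (FinP.punchOut-injective (λ y≡fx → miss (x , sym y≡fx)) (λ y≡fx′ → miss (x′ , sym y≡fx′)) eq)

  injective⇒permutation : ∀ {n} (f : Fin n → Fin n) → Injective _≡_ _≡_ f → Permutation n n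
  injective⇒permutation f f-inj = permutation f f⁻¹ (λ y → proj₂ (surj y)) (λ x → f-inj (proj₂ (surj (f x))))
    where
    surj : ∀ y → Σ (Fin _) λ x → f x ≡ y
    surj = injective⇒surjective f f-inj
    f⁻¹ : Fin _ → Fin _
    f⁻¹ y = proj₁ (surj y)

open Arithmetic

module PeriodicSums {c ℓ} (R : CommutativeSemiring c ℓ) where
  open CommutativeSemiring R
  open import Algebra.Properties.Semiring.Sum semiring
    using (sum; sum-cong-≋; sum-cong-≗; sum-permute; sum-replicate; ∑-comm; *-distribˡ-sum; *-distribʳ-sum)
  open import Algebra.Properties.Semiring.Mult semiring using (_×_; ×-assoc-*; ×-congʳ)
  open import Relation.Binary.Reasoning.Setoid setoid

  Σ< : ℕ → (ℕ → Carrier) → Carrier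
  Σ< n h = sum (λ (i : Fin n) → h (toℕ i))

  Periodic : ℕ → (ℕ → Carrier) → Set ℓ
  Periodic p h = ∀ t x → h (t ℕ.* p ℕ.+ x) ≈ h x

  Σ<-cong : ∀ n {f g} → (∀ k → f k ≈ g k) → Σ< n f ≈ Σ< n g
  Σ<-cong n {f} {g} f≈g = sum-cong-≋ {n} {f ∘ toℕ} {g ∘ toℕ} (f≈g ∘ toℕ)

  Σ<-snoc : ∀ n h → Σ< (suc n) h ≈ Σ< n h + h n
  Σ<-snoc zero    h = +-comm _ _
  Σ<-snoc (suc n) h = trans (+-congˡ (Σ<-snoc n (h ∘ suc))) (sym (+-assoc _ _ _))

  Σ<-+ : ∀ m n h → Σ< (m ℕ.+ n) h ≈ Σ< m h + Σ< n (λ k → h (m ℕ.+ k))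
  Σ<-+ zero    n h = sym (+-identityˡ _)
  Σ<-+ (suc m) n h = trans (+-congˡ (Σ<-+ m n (h ∘ suc))) (sym (+-assoc _ _ _))

  Σ<-blocks : ∀ t p h → Σ< (t ℕ.* p) h ≈ Σ< t (λ s → Σ< p (λ j → h (s ℕ.* p ℕ.+ j)))
  Σ<-blocks zero    p h = refl
  Σ<-blocks (suc t) p h = trans (Σ<-+ p (t ℕ.* p) h) (+-congˡ (trans
    (Σ<-blocks t p (λ k → h (p ℕ.+ k)))
    (Σ<-cong t λ s → Σ<-cong p λ j → reflexive (≡.cong h (≡.sym (ℕP.+-assoc p (s ℕ.* p) j))))))

  Σ<-const : ∀ n x → Σ< n (λ _ → x) ≈ (n × 1#) * x
  Σ<-const n x = trans (sum-replicate n) (sym (trans (×-assoc-* n 1# x) (×-congʳ n (*-identityˡ x))))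

  Σ<-periodic : ∀ {p h} → Periodic p h → ∀ t → Σ< (t ℕ.* p) h ≈ (t × 1#) * Σ< p h
  Σ<-periodic {p} {h} per t = begin
    Σ< (t ℕ.* p) h                              ≈⟨ Σ<-blocks t p h ⟩
    Σ< t (λ s → Σ< p (λ j → h (s ℕ.* p ℕ.+ j))) ≈⟨ Σ<-cong t (λ s → Σ<-cong p (per s)) ⟩
    Σ< t (λ _ → Σ< p h)                         ≈⟨ Σ<-const t (Σ< p h) ⟩
    (t × 1#) * Σ< p h                           ∎

  Σ<-shift : ∀ {p h} → Periodic p h → Σ< p (h ∘ suc) ≈ Σ< p h
  Σ<-shift {zero}      per = refl
  Σ<-shift {suc p} {h} per = begin
    Σ< (suc p) (h ∘ suc)       ≈⟨ Σ<-snoc p (h ∘ suc) ⟩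
    Σ< p (h ∘ suc) + h (suc p) ≈⟨ +-comm _ _ ⟩
    h (suc p) + Σ< p (h ∘ suc) ≈⟨ +-congʳ h[p+1]≈h[0] ⟩
    h 0 + Σ< p (h ∘ suc)       ∎
    where
    one-period : suc p ≡ 1 ℕ.* suc p ℕ.+ 0
    one-period = ≡.sym (≡.trans (ℕP.+-identityʳ _) (ℕP.*-identityˡ _))
    h[p+1]≈h[0] : h (suc p) ≈ h 0
    h[p+1]≈h[0] = trans (reflexive (≡.cong h one-period)) (per 1 0)

  periodic-mod : ∀ {p h} → Periodic p h → .{{_ : NonZero p}} → ∀ x → h x ≈ h (x % p)
  periodic-mod {p} {h} per x = trans
    (reflexive (≡.cong h (≡.trans (m≡m%n+[m/n]*n x p) (ℕP.+-comm (x % p) (x / p ℕ.* p)))))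
    (per (x / p) (x % p))

  sum-injective-reindex : ∀ {n} (f : Fin n → Fin n) → Injective _≡_ _≡_ f →
                          ∀ v → sum (v ∘ f) ≈ sum v
  sum-injective-reindex f f-inj v = sym (sum-permute v (injective⇒permutation f f-inj))

  -- for q coprime to p, the progression s q + j (s < p) runs over all residues mod p
  Σ<-affine : ∀ {p a} → Periodic p a → .{{_ : NonZero p}} → ∀ {q} → Coprime p q → ∀ j →
              Σ< p (λ s → a (s ℕ.* q ℕ.+ j)) ≈ Σ< p a
  Σ<-affine {p} {a} per {q} cop j = begin
    Σ< p (λ s → a (s ℕ.* q ℕ.+ j))
      ≈⟨ Σ<-cong p (λ s → periodic-mod per (s ℕ.* q ℕ.+ j)) ⟩
    Σ< p (λ s → a ((s ℕ.* q ℕ.+ j) % p))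
      ≡⟨ sum-cong-≗ {p} {λ s → a ((toℕ s ℕ.* q ℕ.+ j) % p)} (λ s → ≡.cong a (≡.sym (FinP.toℕ-fromℕ< _))) ⟩
    sum (a ∘ toℕ ∘ affine p q j)
      ≈⟨ sum-injective-reindex (affine p q j) (affine-injective p q j cop) (a ∘ toℕ) ⟩
    Σ< p a
      ∎

  Σ<-product : ∀ {p q a b} → Periodic p a → Periodic q b → .{{_ : NonZero p}} → Coprime p q →
               Σ< (p ℕ.* q) (λ k → a k * b k) ≈ Σ< p a * Σ< q b
  Σ<-product {p} {q} {a} {b} per-a per-b cop = begin
    Σ< (p ℕ.* q) (λ k → a k * b k)
      ≈⟨ Σ<-blocks p q (λ k → a k * b k) ⟩
    Σ< p (λ s → Σ< q (λ j → a (s ℕ.* q ℕ.+ j) * b (s ℕ.* q ℕ.+ j)))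
      ≈⟨ Σ<-cong p (λ s → Σ<-cong q (λ j → *-congˡ {a (s ℕ.* q ℕ.+ j)} (per-b s j))) ⟩
    Σ< p (λ s → Σ< q (λ j → a (s ℕ.* q ℕ.+ j) * b j))
      ≈⟨ ∑-comm {p} {q} (λ s j → a (toℕ s ℕ.* q ℕ.+ toℕ j) * b (toℕ j)) ⟩
    Σ< q (λ j → Σ< p (λ s → a (s ℕ.* q ℕ.+ j) * b j))
      ≈⟨ Σ<-cong q (λ j → sym (*-distribʳ-sum {p} (b j) (λ s → a (toℕ s ℕ.* q ℕ.+ j)))) ⟩
    Σ< q (λ j → Σ< p (λ s → a (s ℕ.* q ℕ.+ j)) * b j)
      ≈⟨ Σ<-cong q (λ j → *-congʳ {b j} (Σ<-affine per-a cop j)) ⟩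
    Σ< q (λ j → Σ< p a * b j)
      ≈⟨ sym (*-distribˡ-sum {q} (Σ< p a) (b ∘ toℕ)) ⟩
    Σ< p a * Σ< q b
      ∎

module Means {c ℓ} (A : ℚAlgebra c ℓ) where
  open ℚAlgebra A
  open PeriodicSums commutativeSemiring public
  open import Algebra.Properties.Semiring.Mult semiring using (_×_; ×1-homo-*)
  open import Algebra.Properties.CommutativeSemigroup *-commutativeSemigroup using (interchange)
  open import Relation.Binary.Reasoning.Setoid setoid

  fromℕ≡×1# : ∀ n → fromℕ R n ≡ n × 1#
  fromℕ≡×1# zero    = ≡.refl
  fromℕ≡×1# (suc n) = ≡.cong (_+_ 1#) (fromℕ≡×1# n)

  ×1#-inverse : ∀ n → NonZero n → (n × 1#) * inv n ≈ 1#
  ×1#-inverse n n≢0 = trans (reflexive (≡.cong (_* inv n) (≡.sym (fromℕ≡×1# n)))) (inv-correct n n≢0)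

  inv-unique : ∀ n x → NonZero n → (n × 1#) * x ≈ 1# → x ≈ inv n
  inv-unique n x n≢0 nx≈1 = begin
    x                          ≈⟨ *-identityʳ x ⟨
    x * 1#                     ≈⟨ *-congˡ (×1#-inverse n n≢0) ⟨
    x * ((n × 1#) * inv n)     ≈⟨ *-assoc _ _ _ ⟨
    (x * (n × 1#)) * inv n     ≈⟨ *-congʳ (trans (*-comm _ _) nx≈1) ⟩
    1# * inv n                 ≈⟨ *-identityˡ _ ⟩
    inv n                      ∎

  inv-* : ∀ m n → NonZero m → NonZero n → inv (m ℕ.* n) ≈ inv m * inv n
  inv-* m n m≢0 n≢0 = sym (inv-unique (m ℕ.* n) (inv m * inv n) (ℕP.m*n≢0 m n {{m≢0}} {{n≢0}}) (begin
    ((m ℕ.* n) × 1#) * (inv m * inv n)      ≈⟨ *-congʳ (×1-homo-* m n) ⟩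
    ((m × 1#) * (n × 1#)) * (inv m * inv n) ≈⟨ interchange _ _ _ _ ⟩
    ((m × 1#) * inv m) * ((n × 1#) * inv n) ≈⟨ *-cong (×1#-inverse m m≢0) (×1#-inverse n n≢0) ⟩
    1# * 1#                                 ≈⟨ *-identityˡ 1# ⟩
    1#                                      ∎))

  mean : ℕ → (ℕ → Carrier) → Carrier
  mean n h = inv n * Σ< n h

  mean-cong : ∀ n {f g} → (∀ k → f k ≈ g k) → mean n f ≈ mean n g
  mean-cong n f≈g = *-congˡ (Σ<-cong n f≈g)

  mean-const : ∀ n x → NonZero n → mean n (λ _ → x) ≈ x
  mean-const n x n≢0 = begin
    inv n * Σ< n (λ _ → x)   ≈⟨ *-congˡ (Σ<-const n x) ⟩
    inv n * ((n × 1#) * x)   ≈⟨ *-assoc _ _ _ ⟨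
    (inv n * (n × 1#)) * x   ≈⟨ *-congʳ (trans (*-comm _ _) (×1#-inverse n n≢0)) ⟩
    1# * x                   ≈⟨ *-identityˡ x ⟩
    x                        ∎

  mean-periodic : ∀ {p h M} → Periodic p h → NonZero M → p ∣ M → mean M h ≈ mean p h
  mean-periodic {p} {h} per M≢0 (divides t ≡.refl) = begin
    inv (t ℕ.* p) * Σ< (t ℕ.* p) h          ≈⟨ *-cong (inv-* t p t≢0 p≢0) (Σ<-periodic per t) ⟩
    (inv t * inv p) * ((t × 1#) * Σ< p h)   ≈⟨ interchange _ _ _ _ ⟩
    (inv t * (t × 1#)) * mean p h           ≈⟨ *-congʳ (trans (*-comm _ _) (×1#-inverse t t≢0)) ⟩
    1# * mean p h                           ≈⟨ *-identityˡ _ ⟩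
    mean p h                                ∎
    where
    t≢0 : NonZero t
    t≢0 = ℕP.m*n≢0⇒m≢0 t {{M≢0}}
    p≢0 : NonZero p
    p≢0 = ℕP.m*n≢0⇒n≢0 t {{M≢0}}

  mean-product : ∀ {p q a b} → Periodic p a → Periodic q b → NonZero p → NonZero q → Coprime p q →
                 mean (p ℕ.* q) (λ k → a k * b k) ≈ mean p a * mean q b
  mean-product {p} {q} {a} {b} per-a per-b p≢0 q≢0 cop = begin
    inv (p ℕ.* q) * Σ< (p ℕ.* q) (λ k → a k * b k)
      ≈⟨ *-cong (inv-* p q p≢0 q≢0) (Σ<-product per-a per-b {{p≢0}} cop) ⟩
    (inv p * inv q) * (Σ< p a * Σ< q b)
      ≈⟨ interchange _ _ _ _ ⟩
    mean p a * mean q b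
      ∎

  sumTo-periodic : ∀ {M h} → Periodic M h → sumTo A M h ≈ Σ< M h
  sumTo-periodic {M} {h} per = trans (sumTo≈Σ<∘suc M) (Σ<-shift per)
    where
    sumTo≈Σ<∘suc : ∀ n → sumTo A n h ≈ Σ< n (h ∘ suc)
    sumTo≈Σ<∘suc zero    = refl
    sumTo≈Σ<∘suc (suc n) = trans (+-congʳ (sumTo≈Σ<∘suc n)) (sym (Σ<-snoc n (h ∘ suc)))

module FinProducts {c ℓ} (A : ℚAlgebra c ℓ) where
  open ℚAlgebra A
  open import Algebra.Properties.CommutativeSemigroup *-commutativeSemigroup using (interchange)

  prodFin-cong : ∀ {r} {f g : Fin r → Carrier} → (∀ i → f i ≈ g i) → prodFin A f ≈ prodFin A g
  prodFin-cong {zero}  f≈g = refl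
  prodFin-cong {suc r} f≈g = *-cong (f≈g Fin.zero) (prodFin-cong (f≈g ∘ Fin.suc))

  prodFin-* : ∀ {r} (u v : Fin r → Carrier) → prodFin A (λ i → u i * v i) ≈ prodFin A u * prodFin A v
  prodFin-* {zero}  u v = sym (*-identityˡ 1#)
  prodFin-* {suc r} u v = trans (*-congˡ (prodFin-* (u ∘ Fin.suc) (v ∘ Fin.suc))) (interchange _ _ _ _)

  prodFin-one : ∀ {r} (u : Fin r → Carrier) → (∀ i → u i ≈ 1#) → prodFin A u ≈ 1#
  prodFin-one {zero}  u u≈1 = refl
  prodFin-one {suc r} u u≈1 = trans (*-cong (u≈1 Fin.zero) (prodFin-one (u ∘ Fin.suc) (u≈1 ∘ Fin.suc))) (*-identityˡ 1#)

module Multiplicativity {c ℓ} (A : ℚAlgebra c ℓ) {r} (F : Fin r → ℕ → ℚAlgebra.Carrier A)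
                        (F-mult : ∀ i → IsMultiplicative A (F i)) (G : Fin r → IntPoly) where
  open ℚAlgebra A
  open Means A
  open FinProducts A
  open import Relation.Binary.Reasoning.Setoid setoid

  term : (Fin r → ℕ) → ℕ → Carrier
  term m k = prodFin A (λ i → F i (gcd ∣ eval (G i) (+ k) ∣ (m i)))

  term-periodic : ∀ m {P} → (∀ i → m i ∣ P) → Periodic P (term m)
  term-periodic m m∣P t x = prodFin-cong λ i →
    reflexive (≡.cong (F i) (gcd-poly-periodic (G i) (m i) x (∣-trans (m∣P i) (n∣m*n t))))

  S≈mean : ∀ m → S A F G m ≈ mean (lcmFin m) (term m)
  S≈mean m = *-congˡ (sumTo-periodic (term-periodic m (lcmFin-∣ m)))

  -- for fixed k, term is multiplicative in m, as gcd(gᵢ(k), ·) and each fᵢ are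
  term-multiplicative : ∀ m n → (∀ i → NonZero (m i)) → (∀ i → NonZero (n i)) →
    Coprime (prodℕ m) (prodℕ n) → ∀ k → term (λ i → m i ℕ.* n i) k ≈ term m k * term n k
  term-multiplicative m n m≢0 n≢0 cop k = trans (prodFin-cong factor)
    (prodFin-* (λ i → F i (gcd (value i) (m i))) (λ i → F i (gcd (value i) (n i))))
    where
    value : Fin r → ℕ
    value i = ∣ eval (G i) (+ k) ∣
    factor : ∀ i → F i (gcd (value i) (m i ℕ.* n i)) ≈ F i (gcd (value i) (m i)) * F i (gcd (value i) (n i))
    factor i = trans (reflexive (≡.cong (F i) (gcd-*-coprime (value i) (m i) (n i) mᵢ⊥nᵢ)))
      (proj₂ (F-mult i) _ _ (divisor-nonZero gₘ∣mᵢ (m≢0 i)) (divisor-nonZero gₙ∣nᵢ (n≢0 i))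
        (coprime-∣ gₘ∣mᵢ gₙ∣nᵢ mᵢ⊥nᵢ))
      where
      mᵢ⊥nᵢ : Coprime (m i) (n i)
      mᵢ⊥nᵢ = coprime-∣ (prodℕ-∣ m i) (prodℕ-∣ n i) cop
      gₘ∣mᵢ : gcd (value i) (m i) ∣ m i
      gₘ∣mᵢ = gcd[m,n]∣n (value i) (m i)
      gₙ∣nᵢ : gcd (value i) (n i) ∣ n i
      gₙ∣nᵢ = gcd[m,n]∣n (value i) (n i)

  -- S(mn) = S(m) S(n): pass to the common period lcm(m) lcm(n), split each
  -- term (fact 2 of the overview) and factor the mean (fact 3)
  S-multiplicative : ∀ m n → (∀ i → NonZero (m i)) → (∀ i → NonZero (n i)) →
    Coprime (prodℕ m) (prodℕ n) → S A F G (λ i → m i ℕ.* n i) ≈ S A F G m * S A F G n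
  S-multiplicative m n m≢0 n≢0 cop = begin
    S A F G mn                                ≈⟨ S≈mean mn ⟩
    mean (lcmFin mn) (term mn)                ≈⟨ mean-periodic (term-periodic mn (lcmFin-∣ mn)) LₘLₙ≢0 Lₘₙ∣LₘLₙ ⟨
    mean (Lₘ ℕ.* Lₙ) (term mn)                ≈⟨ mean-cong (Lₘ ℕ.* Lₙ) (term-multiplicative m n m≢0 n≢0 cop) ⟩
    mean (Lₘ ℕ.* Lₙ) (λ k → term m k * term n k)
      ≈⟨ mean-product (term-periodic m (lcmFin-∣ m)) (term-periodic n (lcmFin-∣ n)) Lₘ≢0 Lₙ≢0 Lₘ⊥Lₙ ⟩
    mean Lₘ (term m) * mean Lₙ (term n)       ≈⟨ *-cong (S≈mean m) (S≈mean n) ⟨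
    S A F G m * S A F G n                     ∎
    where
    mn : Fin r → ℕ
    mn i = m i ℕ.* n i
    Lₘ Lₙ : ℕ
    Lₘ = lcmFin m
    Lₙ = lcmFin n
    Lₘ≢0 : NonZero Lₘ
    Lₘ≢0 = lcmFin-nonZero m m≢0
    Lₙ≢0 : NonZero Lₙ
    Lₙ≢0 = lcmFin-nonZero n n≢0
    LₘLₙ≢0 : NonZero (Lₘ ℕ.* Lₙ)
    LₘLₙ≢0 = ℕP.m*n≢0 Lₘ Lₙ {{Lₘ≢0}} {{Lₙ≢0}}
    Lₘₙ∣LₘLₙ : lcmFin mn ∣ Lₘ ℕ.* Lₙ
    Lₘₙ∣LₘLₙ = lcmFin-least mn (λ i → *-pres-∣ (lcmFin-∣ m i) (lcmFin-∣ n i))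
    Lₘ⊥Lₙ : Coprime Lₘ Lₙ
    Lₘ⊥Lₙ = coprime-∣ (lcmFin∣prodℕ m) (lcmFin∣prodℕ n) cop

  -- S(1, …, 1) = 1: gcd(x, 1) = 1 and fᵢ(1) = 1, so every term is 1
  S-one : S A F G (λ _ → 1) ≈ 1#
  S-one = begin
    S A F G ones                  ≈⟨ S≈mean ones ⟩
    mean (lcmFin ones) (term ones) ≈⟨ mean-cong (lcmFin ones) term-one ⟩
    mean (lcmFin ones) (λ _ → 1#)  ≈⟨ mean-const (lcmFin ones) 1# (lcmFin-nonZero ones (λ _ → _)) ⟩
    1#                             ∎
    where
    ones : Fin r → ℕ
    ones _ = 1
    term-one : ∀ k → term ones k ≈ 1#
    term-one k = prodFin-one _ λ i → trans (reflexive (≡.cong (F i) (gcd-zeroʳ (∣ eval (G i) (+ k) ∣)))) (proj₁ (F-mult i))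

corollary1 : {c ℓ : Level} (A : ℚAlgebra c ℓ) (r : ℕ) → 1 ≤ r →
    (F : Fin r → ℕ → ℚAlgebra.Carrier A) →
    (∀ i → IsMultiplicative A (F i)) →
    (G : Fin r → IntPoly) →
    IsMultiplicativeᵣ A (S A F G)
corollary1 A r _ F F-mult G = ((λ _ → 1) , (λ _ → _) , S-one≉0) , S-multiplicative
  where
  open ℚAlgebra A using (_≈_; 0#; nontrivial; trans; sym)
  open Multiplicativity A F F-mult G
  S-one≉0 : ¬ (S A F G (λ _ → 1) ≈ 0#)
  S-one≉0 S≈0 = nontrivial (trans (sym S-one) S≈0)
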